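{- Let $r>t\ge 3$ be integers such that $r=mt-a$ with integers $2\le m<a<t$. Then for every positive integer $n$, $$f(n,r,t+1)\ge\delta(n,r,t)\ge (r-1)n-(m-1)\left\lceil\frac{(m(t-1-a+m)-1)\,n}{m(t-a+m)-2}\right\rceil.$$
   Context: For positive integers $n,r$, an $r$-partite graph with parts of size $n$ is a graph $G$ whose vertex set is partitioned into $r$ independent sets $V_1,\dots,V_r$, each of size $n$. For $s\ge 2$, $f(n,r,s)$ denotes the largest minimum degree $\delta(G)$ among all $r$-partite graphs $G$ with parts of size $n$ that contain no copy of $K_{s}$. $\mathcal{G}(n,r,t)$ is the family of all $r$-partite graphs with parts of size $n$ and chromatic number at most $t$, and $\delta(n,r,t):=\max\{\delta(G): G\in\mathcal{G}(n,r,t)\}$. -}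

module Defs where

open import Data.Nat using (ℕ; zero; suc; _+_; _*_; _∸_; _≤_; _/_)
open import Data.Fin using (Fin)
open import Data.Bool using (Bool; true; false; if_then_else_)
open import Data.List using (List; map; allFin)
open import Data.Nat.ListAction using (sum)
open import Data.Empty using (⊥)
open import Data.Product using (Σ; _×_; _,_; ∃)
open import Relation.Binary.PropositionalEquality using (_≡_; _≢_)

Vertex : ℕ → ℕ → Set
Vertex n r = Fin r × Fin n

part : ∀ {n r} → Vertex n r → Fin r
part (i , _) = i

record RPartite (n r : ℕ) : Set where
  field
    adj       : Vertex n r → Vertex n r → Bool
    symmetric : ∀ u v → adj u v ≡ adj v u
    partsIndependent : ∀ u v → part u ≡ part v → adj u v ≡ false
open RPartite public

sumFin : ∀ k → (Fin k → ℕ) → ℕ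
sumFin k f = sum (map f (allFin k))

degree : ∀ {n r} → RPartite n r → Vertex n r → ℕ
degree {n} {r} G v =
  sumFin r (λ i → sumFin n (λ x → if adj G v (i , x) then 1 else 0))

MinDegree : ∀ {n r} → RPartite n r → ℕ → Set
MinDegree G d = (∀ v → d ≤ degree G v) × ∃ (λ v → degree G v ≡ d)

ContainsK : ∀ {n r} → ℕ → RPartite n r → Set
ContainsK {n} {r} s G =
  Σ (Fin s → Vertex n r) λ φ →
    ∀ (p q : Fin s) → p ≢ q → adj G (φ p) (φ q) ≡ true

ChromaticAtMost : ∀ {n r} → ℕ → RPartite n r → Set
ChromaticAtMost {n} {r} t G =
  Σ (Vertex n r → Fin t) λ c →
    ∀ u v → adj G u v ≡ true → c u ≢ c v

IsF : ℕ → ℕ → ℕ → ℕ → Set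
IsF n r s d =
  (Σ (RPartite n r) λ G → (ContainsK s G → ⊥) × MinDegree G d)
  × (∀ (G : RPartite n r) e → (ContainsK s G → ⊥) → MinDegree G e → e ≤ d)

IsDelta : ℕ → ℕ → ℕ → ℕ → Set
IsDelta n r t d =
  (Σ (RPartite n r) λ G → ChromaticAtMost t G × MinDegree G d)
  × (∀ (G : RPartite n r) e → ChromaticAtMost t G → MinDegree G e → e ≤ d)

-- ⌈ x / y ⌉ for y > 0 (convention: 0 when y = 0, never used here)
ceilDiv : ℕ → ℕ → ℕ
ceilDiv x zero    = 0
ceilDiv x (suc k) = (x + k) / suc k

module Submission where

-- Write X = t - 1 - a + m and b = a - m, so that r = mX + (m - 1) b and
-- t = X + 1 + b. Split the parts into X groups of m parts and b blocks of
-- m - 1 parts. In group g the first k vertices of every part get colour g and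
-- the others a spare colour X; block h is coloured X + 1 + h throughout.
-- Joining all pairs of vertices in different parts with different colours
-- gives a t-colourable graph where a vertex misses, outside its own part,
-- only the rest of its colour class: (m - 1) k vertices for a grouped colour,
-- (mX - 1)(n - k) for the spare one and (m - 2) n for a block colour. With
-- k = ⌈(mX - 1) n / (mX + m - 2)⌉ all three are at most (m - 1) k, so
-- δ(n,r,t) ≥ (r - 1) n - (m - 1) k. The extremal values exist because the
-- graphs, colourings and cliques range over finite sets, and
-- δ(n,r,t) ≤ f(n,r,t+1) since a t-colourable graph contains no K_{t+1}.

open import Defs
open import Data.Bool using (Bool; true; false; if_then_else_)
open import Data.Bool.Properties using () renaming (_≟_ to _≟ᴮ_)
open import Data.Empty using (⊥-elim)
open import Data.Fin using (Fin; zero; suc; toℕ; fromℕ<)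
open import Data.Fin.Properties using (any?; all?; *↔×; pigeonhole; toℕ<n; toℕ-fromℕ<)
  renaming (_≟_ to _≟ᶠ_; <⇒≢ to <⇒≢ᶠ)
open import Data.Integer using (+_; _-_; _⊖_; +≤+) renaming (_≤_ to _≤ℤ_)
import Data.Integer.Properties as ℤ
open import Data.List using (tabulate; allFin)
open import Data.List.Extrema.Nat using (argmin; f[argmin]≤f[xs])
open import Data.List.Membership.Propositional.Properties using (∈-allFin)
open import Data.List.Properties using (map-tabulate; map-cong)
import Data.List.Relation.Unary.All as All
open import Data.Nat
  using (ℕ; zero; suc; _+_; _∸_; _*_; _/_; _%_; NonZero; _≤_; _<_; z≤n; s≤s; z<s; s<s; s≤s⁻¹; _≟_; _<?_)
open import Data.Nat.DivMod using (m≡m%n+[m/n]*n; m%n<n; m/n*n≤m; m<n*o⇒m/o<n)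
open import Data.Nat.ListAction using (sum)
open import Data.Nat.Properties
open import Data.Nat.Tactic.RingSolver using (solve-∀)
open import Algebra.Properties.CommutativeSemigroup +-commutativeSemigroup using (interchange)
open import Data.Product using (Σ; ∃; _×_; _,_; proj₁; proj₂; uncurry)
open import Data.Product.Function.NonDependent.Propositional using (_×-↔_)
open import Data.Vec.Functional using (_∷_)
open import Function using (id; _∘_; _↔_; Inverse; mk⇔)
open import Function.Properties.Inverse using (↔-trans)
open import Relation.Binary.PropositionalEquality
open import Relation.Nullary using (Dec; yes; no; does; ¬_; ¬?; contradiction)
open import Relation.Nullary.Decidable
  using (map′; _×-dec_; _→-dec_; does-⇔; dec-true; dec-false; decidable-stable)
open import Relation.Unary using (Decidable)

-- Exhaustive search over finite types

Exhaustible : Set → Set₁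
Exhaustible A = ∀ {P : A → Set} → Decidable P → Dec (∃ P)

Extensional : {A B : Set} → ((A → B) → Set) → Set
Extensional P = ∀ {f g} → (∀ x → f x ≡ g x) → P f → P g

exhaustible-Bool : Exhaustible Bool
exhaustible-Bool P? with P? true | P? false
... | yes p | _     = yes (true , p)
... | no _  | yes p = yes (false , p)
... | no ¬t | no ¬f = no λ { (true , p) → ¬t p ; (false , p) → ¬f p }

exhaustible-Fin : ∀ {k} → Exhaustible (Fin k)
exhaustible-Fin = any?

exhaustible-↔ : ∀ {k A} → Fin k ↔ A → Exhaustible A
exhaustible-↔ enum {P} P? =
  map′ (λ (i , p) → to i , p) (λ (x , p) → from x , subst P (sym (strictlyInverseˡ x)) p)
       (exhaustible-Fin (P? ∘ to))
  where open Inverse enum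

exhaustible⇒all? : ∀ {A} → Exhaustible A → ∀ {P : A → Set} → Decidable P → Dec (∀ x → P x)
exhaustible⇒all? search P? with search (¬? ∘ P?)
... | yes (x , ¬px) = no λ all → ¬px (all x)
... | no ¬∃ = yes λ x → decidable-stable (P? x) (λ ¬px → ¬∃ (x , ¬px))

-- Without function extensionality a search over a function space can only
-- find witnesses up to pointwise equality, hence the restriction to
-- extensional predicates.
exhaustible-Fin→ : ∀ {B} → Exhaustible B → ∀ k {P : (Fin k → B) → Set}
  → Extensional P → Decidable P → Dec (∃ P)
exhaustible-Fin→ {B} search zero ext P? =
  map′ (λ p → none , p) (λ (f , p) → ext {f} {none} (λ ()) p) (P? none)
  where
  none : Fin zero → B
  none ()
exhaustible-Fin→ search (suc k) {P} ext P? =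
  map′ (λ (b , g , p) → b ∷ g , p)
       (λ (f , p) → f zero , f ∘ suc , ext (λ { zero → refl ; (suc i) → refl }) p)
       (search λ b → exhaustible-Fin→ search k (ext ∘ ∷-cong b) (P? ∘ (b ∷_)))
  where
  ∷-cong : ∀ b {f g} → (∀ i → f i ≡ g i) → ∀ i → (b ∷ f) i ≡ (b ∷ g) i
  ∷-cong b f≗g zero    = refl
  ∷-cong b f≗g (suc i) = f≗g i

exhaustible-→ : ∀ {k A B} → Fin k ↔ A → Exhaustible B → ∀ {P : (A → B) → Set}
  → Extensional P → Decidable P → Dec (∃ P)
exhaustible-→ {k} enum search ext P? =
  map′ (λ (g , p) → g ∘ from , p)
       (λ (f , p) → f ∘ to , ext (λ x → cong f (sym (strictlyInverseˡ x))) p)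
       (exhaustible-Fin→ search k (λ f≗g → ext (f≗g ∘ from)) (P? ∘ (_∘ from)))
  where open Inverse enum

greatest : {P : ℕ → Set} → Decidable P → ∀ b → (∀ d → P d → d ≤ b)
  → ∀ {d₀} → P d₀ → Σ ℕ λ d → P d × (∀ e → P e → e ≤ d)
greatest P? b bound p₀ with P? b
... | yes pb = b , pb , bound
greatest {P} P? zero bound p₀ | no ¬pb = ⊥-elim (¬pb (subst P (n≤0⇒n≡0 (bound _ p₀)) p₀))
greatest P? (suc b) bound p₀ | no ¬pb =
  greatest P? b (λ e pe → s≤s⁻¹ (≤∧≢⇒< (bound e pe) λ { refl → ¬pb pe })) p₀

-- Sums over ranges of ℕ

sumFin-tabulate : ∀ k (f : Fin k → ℕ) → sumFin k f ≡ sum (tabulate f)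
sumFin-tabulate k f = cong sum (map-tabulate id f)

sumFin-cong : ∀ {k} {f g : Fin k → ℕ} → (∀ i → f i ≡ g i) → sumFin k f ≡ sumFin k g
sumFin-cong {k} f≗g = cong sum (map-cong f≗g (allFin k))

sum-tabulate-≤ : ∀ k {f : Fin k → ℕ} {c} → (∀ i → f i ≤ c) → sum (tabulate f) ≤ k * c
sum-tabulate-≤ zero    f≤c = z≤n
sum-tabulate-≤ (suc k) f≤c = +-mono-≤ (f≤c zero) (sum-tabulate-≤ k (f≤c ∘ suc))

sumFin-≤ : ∀ k {f : Fin k → ℕ} {c} → (∀ i → f i ≤ c) → sumFin k f ≤ k * c
sumFin-≤ k {f} f≤c = ≤-trans (≤-reflexive (sumFin-tabulate k f)) (sum-tabulate-≤ k f≤c)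

∑ : ℕ → (ℕ → ℕ) → ℕ
∑ zero    F = 0
∑ (suc n) F = F 0 + ∑ n (F ∘ suc)

syntax ∑ n (λ j → F) = ∑[ j < n ] F

sum-tabulate≡∑ : ∀ k {f : Fin k → ℕ} {F : ℕ → ℕ} → (∀ i → f i ≡ F (toℕ i)) → sum (tabulate f) ≡ ∑ k F
sum-tabulate≡∑ zero    f≗F = refl
sum-tabulate≡∑ (suc k) f≗F = cong₂ _+_ (f≗F zero) (sum-tabulate≡∑ k (f≗F ∘ suc))

sumFin≡∑ : ∀ k {f : Fin k → ℕ} {F : ℕ → ℕ} → (∀ i → f i ≡ F (toℕ i)) → sumFin k f ≡ ∑ k F
sumFin≡∑ k {f} f≗F = trans (sumFin-tabulate k f) (sum-tabulate≡∑ k f≗F)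

∑-zero : ∀ n {F} → (∀ j → j < n → F j ≡ 0) → ∑ n F ≡ 0
∑-zero zero    F≡0 = refl
∑-zero (suc n) F≡0 = cong₂ _+_ (F≡0 0 z<s) (∑-zero n λ j j<n → F≡0 (suc j) (s<s j<n))

∑-mono-≤ : ∀ n {F G : ℕ → ℕ} → (∀ j → j < n → F j ≤ G j) → ∑ n F ≤ ∑ n G
∑-mono-≤ zero    F≤G = z≤n
∑-mono-≤ (suc n) F≤G = +-mono-≤ (F≤G 0 z<s) (∑-mono-≤ n λ j j<n → F≤G (suc j) (s<s j<n))

∑-const : ∀ n c → ∑[ _ < n ] c ≡ n * c
∑-const zero    c = refl
∑-const (suc n) c = cong (_+_ c) (∑-const n c)

∑-≤ : ∀ n {F c} → (∀ j → j < n → F j ≤ c) → ∑ n F ≤ n * c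
∑-≤ n {F} {c} F≤c = ≤-trans (∑-mono-≤ n F≤c) (≤-reflexive (∑-const n c))

∑-≥ : ∀ n {F c} → (∀ j → j < n → c ≤ F j) → n * c ≤ ∑ n F
∑-≥ n {F} {c} c≤F = ≤-trans (≤-reflexive (sym (∑-const n c))) (∑-mono-≤ n c≤F)

∑-+ : ∀ n (F G : ℕ → ℕ) → ∑[ j < n ] (F j + G j) ≡ ∑ n F + ∑ n G
∑-+ zero    F G = refl
∑-+ (suc n) F G = trans (cong (_+_ (F 0 + G 0)) (∑-+ n (F ∘ suc) (G ∘ suc)))
                        (interchange (F 0) (G 0) _ _)

update : ℕ → ℕ → (ℕ → ℕ) → ℕ → ℕ
update i x F j = if does (j ≟ i) then x else F j

update-here : ∀ i x F → update i x F i ≡ x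
update-here i x F = cong (λ b → if b then x else F i) (dec-true (i ≟ i) refl)

update-there : ∀ {i j} x F → j ≢ i → update i x F j ≡ F j
update-there {i} {j} x F j≢i = cong (λ b → if b then x else F j) (dec-false (j ≟ i) j≢i)

∑-update : ∀ n {i} x F → i < n → ∑ n (update i x F) + F i ≡ ∑ n F + x
∑-update (suc n) {zero}  x F _ = begin
  x + ∑ n (F ∘ suc) + F 0   ≡⟨ +-comm (x + _) (F 0) ⟩
  F 0 + (x + ∑ n (F ∘ suc)) ≡⟨ cong (_+_ (F 0)) (+-comm x _) ⟩
  F 0 + (∑ n (F ∘ suc) + x) ≡⟨ +-assoc (F 0) _ x ⟨
  F 0 + ∑ n (F ∘ suc) + x   ∎
  where open ≡-Reasoning
∑-update (suc n) {suc i} x F (s<s i<n) = begin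
  F 0 + ∑ n (update i x (F ∘ suc)) + F (suc i)   ≡⟨ +-assoc (F 0) _ _ ⟩
  F 0 + (∑ n (update i x (F ∘ suc)) + F (suc i)) ≡⟨ cong (_+_ (F 0)) (∑-update n x (F ∘ suc) i<n) ⟩
  F 0 + (∑ n (F ∘ suc) + x)                      ≡⟨ +-assoc (F 0) _ _ ⟨
  F 0 + ∑ n (F ∘ suc) + x                        ∎
  where open ≡-Reasoning

∑-window : ∀ R lo w {H c} → (∀ j → j < R → j < lo → H j ≡ 0) → (∀ j → j < R → lo + w ≤ j → H j ≡ 0)
  → (∀ j → j < R → H j ≤ c) → ∑ R H ≤ w * c
∑-window zero    lo       w       below above H≤c = z≤n
∑-window (suc R) (suc lo) w {H} below above H≤c =
  ≤-trans (≤-reflexive (cong (_+ ∑ R (H ∘ suc)) (below 0 z<s z<s)))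
    (∑-window R lo w (λ j j<R j<lo → below (suc j) (s<s j<R) (s<s j<lo))
      (λ j j<R le → above (suc j) (s<s j<R) (s≤s le)) (λ j j<R → H≤c (suc j) (s<s j<R)))
∑-window (suc R) zero     zero    {H} below above H≤c =
  ≤-trans (≤-reflexive (cong (_+ ∑ R (H ∘ suc)) (above 0 z<s z≤n)))
    (∑-window R zero zero (λ _ _ ()) (λ j j<R _ → above (suc j) (s<s j<R) z≤n) (λ j j<R → H≤c (suc j) (s<s j<R)))
∑-window (suc R) zero     (suc w) below above H≤c =
  +-mono-≤ (H≤c 0 z<s) (∑-window R zero w (λ _ _ ()) (λ j j<R le → above (suc j) (s<s j<R) (s≤s le))
    (λ j j<R → H≤c (suc j) (s<s j<R)))

𝟙 : {A : Set} → Dec A → ℕ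
𝟙 a? = if does a? then 1 else 0

𝟙≤1 : ∀ {A : Set} (a? : Dec A) → 𝟙 a? ≤ 1
𝟙≤1 (yes _) = ≤-refl
𝟙≤1 (no _)  = z≤n

𝟙-no : ∀ {A : Set} (a? : Dec A) → ¬ A → 𝟙 a? ≡ 0
𝟙-no (yes a) ¬a = ⊥-elim (¬a a)
𝟙-no (no _)  _  = refl

𝟙-mono : ∀ {A B : Set} → (A → B) → (a? : Dec A) (b? : Dec B) → 𝟙 a? ≤ 𝟙 b?
𝟙-mono f (yes a) (yes _) = ≤-refl
𝟙-mono f (yes a) (no ¬b) = ⊥-elim (¬b (f a))
𝟙-mono f (no _)  _       = z≤n

𝟙-cover : ∀ {A B : Set} → (¬ A → B) → (a? : Dec A) (b? : Dec B) → 1 ≤ 𝟙 a? + 𝟙 b?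
𝟙-cover f (yes _) _       = s≤s z≤n
𝟙-cover f (no _)  (yes _) = ≤-refl
𝟙-cover f (no ¬a) (no ¬b) = ⊥-elim (¬b (f ¬a))

indicator≤1 : ∀ b → (if b then 1 else 0) ≤ 1
indicator≤1 true  = ≤-refl
indicator≤1 false = z≤n

does-true⇒ : ∀ {A : Set} (a? : Dec A) → does a? ≡ true → A
does-true⇒ (yes a) _ = a

m≤o+n⇒+m-+n≤+o : ∀ {m n o} → m ≤ o + n → + m - + n ≤ℤ + o
m≤o+n⇒+m-+n≤+o {m} {n} {o} m≤o+n = begin
  + m - + n     ≡⟨ ℤ.[+m]-[+n]≡m⊖n m n ⟩
  m ⊖ n         ≤⟨ ℤ.⊖-monoˡ-≤ n m≤o+n ⟩
  (o + n) ⊖ n   ≡⟨ ℤ.≤-⊖ (m≤n+m n o) ⟩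
  + (o + n ∸ n) ≡⟨ cong +_ (m+n∸n≡m o n) ⟩
  + o           ∎
  where open ℤ.≤-Reasoning

*-≤-pred : ∀ w x → w * x ≤ x + (w ∸ 1) * x
*-≤-pred zero    x = z≤n
*-≤-pred (suc w) x = ≤-refl

/-window : ∀ j d .{{_ : NonZero d}} → j / d * d ≤ j × j < j / d * d + d
/-window j d = m/n*n≤m j d , (begin-strict
  j                  ≡⟨ m≡m%n+[m/n]*n j d ⟩
  j % d + j / d * d  <⟨ +-monoˡ-< (j / d * d) (m%n<n j d) ⟩
  d + j / d * d      ≡⟨ +-comm d _ ⟩
  j / d * d + d      ∎)
  where open ≤-Reasoning

window-shift : ∀ {a j lo w} → a ≤ j → lo ≤ j ∸ a × j ∸ a < lo + w → a + lo ≤ j × j < a + lo + w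
window-shift {a} {j} {lo} {w} a≤j (lo≤j∸a , j∸a<lo+w) =
  ≤-trans (+-monoʳ-≤ a lo≤j∸a) (≤-reflexive (m+[n∸m]≡n a≤j)) ,
  subst₂ _<_ (m+[n∸m]≡n a≤j) (sym (+-assoc a lo w)) (+-monoʳ-< a j∸a<lo+w)

ceilDiv-spec : ∀ x q → x ≤ suc q * ceilDiv x (suc q)
ceilDiv-spec x q = +-cancelʳ-≤ q _ _ (begin
  x + q                       ≡⟨ m≡m%n+[m/n]*n (x + q) (suc q) ⟩
  (x + q) % suc q + k * suc q ≤⟨ +-monoˡ-≤ (k * suc q) (s≤s⁻¹ (m%n<n (x + q) (suc q))) ⟩
  q + k * suc q               ≡⟨ +-comm q _ ⟩
  k * suc q + q               ≡⟨ cong (_+ q) (*-comm k (suc q)) ⟩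
  suc q * k + q               ∎)
  where
  open ≤-Reasoning
  k = ceilDiv x (suc q)

-- Existence of the extremal values

module _ {n r : ℕ} where

  vertices : Fin (r * n) ↔ Vertex n r
  vertices = *↔×

  exhaustible-Vertex : Exhaustible (Vertex n r)
  exhaustible-Vertex = exhaustible-↔ vertices

  -- A record, not a Π-type, so that G and H can be inferred from a proof of G ≈ H.
  record _≈_ (G H : RPartite n r) : Set where
    constructor same-adj
    field adj-≡ : ∀ u v → adj G u v ≡ adj H u v

  Invariant : (RPartite n r → Set) → Set
  Invariant Q = ∀ {G H} → G ≈ H → Q G → Q H

  degree-cong : ∀ {G H} → G ≈ H → ∀ v → degree G v ≡ degree H v
  degree-cong (same-adj G≈H) v = sumFin-cong λ i → sumFin-cong λ x → cong (λ b → if b then 1 else 0) (G≈H v (i , x))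

  degree-≤ : ∀ G v → degree G v ≤ r * n
  degree-≤ G v = sumFin-≤ r λ i →
    ≤-trans (sumFin-≤ n λ x → indicator≤1 (adj G v (i , x))) (≤-reflexive (*-identityʳ n))

  all-vertices? : {P : Vertex n r → Set} → Decidable P → Dec (∀ v → P v)
  all-vertices? = exhaustible⇒all? exhaustible-Vertex

  MinDegree? : ∀ G d → Dec (MinDegree G d)
  MinDegree? G d = all-vertices? (λ v → d ≤? degree G v) ×-dec exhaustible-Vertex (λ v → degree G v ≟ d)

  ChromaticAtMost? : ∀ t G → Dec (ChromaticAtMost t G)
  ChromaticAtMost? t G = exhaustible-→ vertices exhaustible-Fin ext proper?
    where
    Proper : (Vertex n r → Fin t) → Set
    Proper c = ∀ u v → adj G u v ≡ true → c u ≢ c v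
    ext : Extensional Proper
    ext c≗c′ proper u v uv cu≡cv = proper u v uv (trans (c≗c′ u) (trans cu≡cv (sym (c≗c′ v))))
    proper? : Decidable Proper
    proper? c = all-vertices? λ u → all-vertices? λ v → (adj G u v ≟ᴮ true) →-dec ¬? (c u ≟ᶠ c v)

  ContainsK? : ∀ s G → Dec (ContainsK s G)
  ContainsK? s G = exhaustible-Fin→ exhaustible-Vertex s ext clique?
    where
    Clique : (Fin s → Vertex n r) → Set
    Clique φ = ∀ p q → p ≢ q → adj G (φ p) (φ q) ≡ true
    ext : Extensional Clique
    ext φ≗ψ clique p q p≢q = subst₂ (λ x y → adj G x y ≡ true) (φ≗ψ p) (φ≗ψ q) (clique p q p≢q)
    clique? : Decidable Clique
    clique? φ = all? λ p → all? λ q → ¬? (p ≟ᶠ q) →-dec (adj G (φ p) (φ q) ≟ᴮ true)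

  MinDegree-invariant : ∀ d → Invariant (λ G → MinDegree G d)
  MinDegree-invariant d G≈H (d≤ , v , deg≡d) =
    (λ u → subst (d ≤_) (degree-cong G≈H u) (d≤ u)) , v , trans (sym (degree-cong G≈H v)) deg≡d

  ChromaticAtMost-invariant : ∀ t → Invariant (ChromaticAtMost t)
  ChromaticAtMost-invariant t (same-adj G≈H) (c , proper) = c , λ u v uv → proper u v (trans (G≈H u v) uv)

  K-free-invariant : ∀ s → Invariant (λ G → ¬ ContainsK s G)
  K-free-invariant s (same-adj G≈H) ¬K (φ , clique) = ¬K (φ , λ p q p≢q → trans (G≈H (φ p) (φ q)) (clique p q p≢q))

  IsAdjacency : (Vertex n r × Vertex n r → Bool) → Set
  IsAdjacency h = (∀ u v → h (u , v) ≡ h (v , u)) × (∀ u v → part u ≡ part v → h (u , v) ≡ false)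

  fromAdjacency : ∀ h → IsAdjacency h → RPartite n r
  fromAdjacency h (sym-h , indep-h) =
    record { adj = λ u v → h (u , v) ; symmetric = sym-h ; partsIndependent = indep-h }

  search-RPartite : ∀ {Q} → Invariant Q → Decidable Q → Dec (∃ Q)
  search-RPartite {Q} inv Q? =
    map′ (λ (h , ok , q) → fromAdjacency h ok , q)
         (λ (G , q) → (λ (u , v) → adj G u v) , (symmetric G , partsIndependent G) , inv (same-adj λ _ _ → refl) q)
         (exhaustible-→ (↔-trans *↔× (vertices ×-↔ vertices)) exhaustible-Bool ext P?)
    where
    P : (Vertex n r × Vertex n r → Bool) → Set
    P h = Σ (IsAdjacency h) λ ok → Q (fromAdjacency h ok)
    ext : Extensional P
    ext h≗h′ ((sym-h , indep-h) , q) =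
      ((λ u v → trans (sym (h≗h′ _)) (trans (sym-h u v) (h≗h′ _))) ,
       (λ u v eq → trans (sym (h≗h′ _)) (indep-h u v eq))) ,
      inv (same-adj λ u v → h≗h′ (u , v)) q
    P? : Decidable P
    P? h with (all-vertices? λ u → all-vertices? λ v → h (u , v) ≟ᴮ h (v , u))
        ×-dec (all-vertices? λ u → all-vertices? λ v → (part u ≟ᶠ part v) →-dec (h (u , v) ≟ᴮ false))
    ... | no ¬ok = no (¬ok ∘ proj₁)
    ... | yes ok = map′ (ok ,_) (λ (_ , q) → inv (same-adj λ _ _ → refl) q) (Q? (fromAdjacency h ok))

  minDegree-exists : ∀ G → Vertex n r → ∃ (MinDegree G)
  minDegree-exists G v₀ = degree G (to i) , (λ v → subst (λ u → degree G (to i) ≤ degree G u)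
      (strictlyInverseˡ v) (All.lookup (f[argmin]≤f[xs] {f = degree G ∘ to} (from v₀) (allFin _)) (∈-allFin (from v))))
    , to i , refl
    where
    open Inverse vertices
    i : Fin (r * n)
    i = argmin (degree G ∘ to) (from v₀) (allFin _)

  -- IsDelta n r t and IsF n r s are, definitionally, Extremal (ChromaticAtMost t)
  -- and Extremal (λ G → ¬ ContainsK s G).
  Extremal : (RPartite n r → Set) → ℕ → Set
  Extremal Q d = (Σ (RPartite n r) λ G → Q G × MinDegree G d) × (∀ G e → Q G → MinDegree G e → e ≤ d)

  extremal-exists : ∀ {Q} → Invariant Q → Decidable Q → ∀ {G d} → Q G → MinDegree G d → ∃ (Extremal Q)
  extremal-exists {Q} inv Q? {G} qG md with greatest P? (r * n) bound (G , qG , md)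
    where
    P : ℕ → Set
    P d = Σ (RPartite n r) λ G → Q G × MinDegree G d
    P? : Decidable P
    P? d = search-RPartite (λ G≈H (q , m) → inv G≈H q , MinDegree-invariant d G≈H m)
                           (λ G → Q? G ×-dec MinDegree? G d)
    bound : ∀ d → P d → d ≤ r * n
    bound d (G , _ , d≤ , v , _) = ≤-trans (d≤ v) (degree-≤ G v)
  ... | d , pd , greatest-d = d , pd , λ G e q m → greatest-d e (G , q , m)

  chromatic⇒K-free : ∀ {t} (G : RPartite n r) → ChromaticAtMost t G → ¬ ContainsK (t + 1) G
  chromatic⇒K-free {t} G (c , proper) (φ , clique)
    with p , q , p<q , cφp≡cφq ← pigeonhole (≤-reflexive (+-comm 1 t)) (c ∘ φ)
    = proper (φ p) (φ q) (clique p q (<⇒≢ᶠ p<q)) cφp≡cφq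

  δ≤f : ∀ {t δ} → IsDelta n r t δ → Σ ℕ λ f → IsF n r (t + 1) f × δ ≤ f
  δ≤f {t} ((G , χ , md) , _)
    with f , isf@(_ , f-max) ← extremal-exists (K-free-invariant (t + 1)) (¬? ∘ ContainsK? (t + 1))
                                 {G} (chromatic⇒K-free G χ) md
    = f , isf , f-max G _ (chromatic⇒K-free G χ) md

  δ-lower-bound : ∀ {t L D} (G : RPartite n r) → ChromaticAtMost t G → Vertex n r
    → (∀ v → L ≤ degree G v + D) → Σ ℕ λ δ → IsDelta n r t δ × (+ L - + D ≤ℤ + δ)
  δ-lower-bound {t} {L} {D} G χ v₀ L≤deg+D
    with e , md@(_ , v , deg-v≡e) ← minDegree-exists G v₀
    with δ , isδ@(_ , δ-max) ← extremal-exists (ChromaticAtMost-invariant t) (ChromaticAtMost? t) {G} χ md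
    = δ , isδ , ℤ.≤-trans (m≤o+n⇒+m-+n≤+o (subst (λ d → L ≤ d + D) deg-v≡e (L≤deg+D v)))
                          (+≤+ (δ-max G e χ md))

  bounds-from-colourable : ∀ {t L D} (G : RPartite n r) → ChromaticAtMost t G → Vertex n r
    → (∀ v → L ≤ degree G v + D)
    → Σ ℕ λ f → Σ ℕ λ δ → IsF n r (t + 1) f × IsDelta n r t δ × δ ≤ f × (+ L - + D ≤ℤ + δ)
  bounds-from-colourable G χ v₀ L≤deg+D
    with δ , isδ , lower ← δ-lower-bound G χ v₀ L≤deg+D
    with f , isf , δ≤f ← δ≤f isδ
    = f , δ , isf , isδ , δ≤f , lower

module ColourGraph (col : ℕ → ℕ → ℕ) where

  Apart : ℕ × ℕ → ℕ × ℕ → Set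
  Apart (j , y) (j′ , y′) = j ≢ j′ × col j y ≢ col j′ y′

  apart? : ∀ p q → Dec (Apart p q)
  apart? (j , y) (j′ , y′) = ¬? (j ≟ j′) ×-dec ¬? (col j y ≟ col j′ y′)

  Apart-sym : ∀ {p q} → Apart p q → Apart q p
  Apart-sym (j≢j′ , c≢c′) = ≢-sym j≢j′ , ≢-sym c≢c′

  coordinates : ∀ {n r} → Vertex n r → ℕ × ℕ
  coordinates (i , x) = toℕ i , toℕ x

  colourGraph : ∀ {n r} → RPartite n r
  colourGraph = record
    { adj              = λ u v → does (apart? (coordinates u) (coordinates v))
    ; symmetric        = λ u v → does-⇔ (mk⇔ Apart-sym Apart-sym) (apart? _ _) (apart? _ _)
    ; partsIndependent = λ u v same-part → dec-false (apart? _ _) λ (j≢j′ , _) → j≢j′ (cong toℕ same-part)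
    }

  colourGraph-chromatic : ∀ {n r t} → (∀ j y → j < r → y < n → col j y < t)
    → ChromaticAtMost t (colourGraph {n} {r})
  colourGraph-chromatic {n} {r} {t} col<t = colour , proper
    where
    colour : Vertex n r → Fin t
    colour (i , x) = fromℕ< (col<t (toℕ i) (toℕ x) (toℕ<n i) (toℕ<n x))
    proper : ∀ u v → adj colourGraph u v ≡ true → colour u ≢ colour v
    proper u v uv cu≡cv = proj₂ (does-true⇒ (apart? _ _) uv)
      (trans (sym (toℕ-fromℕ< _)) (trans (cong toℕ cu≡cv) (toℕ-fromℕ< _)))

  count : ℕ → ℕ → ℕ → ℕ
  count n c j = ∑[ y < n ] 𝟙 (col j y ≟ c)

  count-≤ : ∀ n c j → count n c j ≤ n
  count-≤ n c j = ≤-trans (∑-≤ n λ y _ → 𝟙≤1 (col j y ≟ c)) (≤-reflexive (*-identityʳ n))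

  count-window : ∀ n c j lo w → (∀ y → y < n → col j y ≡ c → lo ≤ y × y < lo + w) → count n c j ≤ w
  count-window n c j lo w window = ≤-trans
    (∑-window n lo w (λ y y<n y<lo → 𝟙-no (col j y ≟ c) λ eq → <⇒≱ y<lo (proj₁ (window y y<n eq)))
                     (λ y y<n le → 𝟙-no (col j y ≟ c) λ eq → <⇒≱ (proj₂ (window y y<n eq)) le)
                     (λ y _ → 𝟙≤1 (col j y ≟ c)))
    (≤-reflexive (*-identityʳ w))

  class-window : ∀ n R c j₀ lo w {K D}
    → (∀ j y → j < R → col j y ≡ c → lo ≤ j × j < lo + w)
    → (∀ j y → col j y ≡ c → col j₀ y ≡ c)
    → count n c j₀ ≤ K → (w ∸ 1) * K ≤ D
    → ∑[ j < R ] count n c j ≤ D + count n c j₀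
  class-window n R c j₀ lo w {K} {D} window ⊆j₀ j₀≤K wK≤D = begin
    ∑[ j < R ] count n c j                ≤⟨ ∑-window R lo w below above (λ j _ → ≤j₀ j) ⟩
    w * count n c j₀                      ≤⟨ *-≤-pred w _ ⟩
    count n c j₀ + (w ∸ 1) * count n c j₀ ≤⟨ +-monoʳ-≤ _ (≤-trans (*-monoʳ-≤ (w ∸ 1) j₀≤K) wK≤D) ⟩
    count n c j₀ + D                      ≡⟨ +-comm (count n c j₀) D ⟩
    D + count n c j₀                      ∎
    where
    open ≤-Reasoning
    vanish : ∀ j → (∀ y → col j y ≢ c) → count n c j ≡ 0
    vanish j ≢c = ∑-zero n λ y _ → 𝟙-no (col j y ≟ c) (≢c y)
    below : ∀ j → j < R → j < lo → count n c j ≡ 0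
    below j j<R j<lo = vanish j λ y eq → <⇒≱ j<lo (proj₁ (window j y j<R eq))
    above : ∀ j → j < R → lo + w ≤ j → count n c j ≡ 0
    above j j<R lo+w≤j = vanish j λ y eq → <⇒≱ (proj₂ (window j y j<R eq)) lo+w≤j
    ≤j₀ : ∀ j → count n c j ≤ count n c j₀
    ≤j₀ j = ∑-mono-≤ n λ y _ → 𝟙-mono (⊆j₀ j y) (col j y ≟ c) (col j₀ y ≟ c)

  degree-colourGraph : ∀ {n r} (i₀ : Fin r) (x₀ : Fin n) →
    degree colourGraph (i₀ , x₀) ≡ ∑[ j < r ] ∑[ y < n ] 𝟙 (apart? (toℕ i₀ , toℕ x₀) (j , y))
  degree-colourGraph {n} {r} i₀ x₀ = sumFin≡∑ r λ i → sumFin≡∑ n λ x → refl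

  other-part-covered : ∀ n j₀ y₀ j → j ≢ j₀ →
    n ≤ ∑[ y < n ] 𝟙 (apart? (j₀ , y₀) (j , y)) + count n (col j₀ y₀) j
  other-part-covered n j₀ y₀ j j≢j₀ = begin
    n      ≡⟨ *-identityʳ n ⟨
    n * 1  ≤⟨ ∑-≥ n (λ y _ → 𝟙-cover (same-colour y) (apart? _ _) (col j y ≟ c)) ⟩
    ∑[ y < n ] (𝟙 (apart? (j₀ , y₀) (j , y)) + 𝟙 (col j y ≟ c)) ≡⟨ ∑-+ n _ _ ⟩
    ∑[ y < n ] 𝟙 (apart? (j₀ , y₀) (j , y)) + count n c j      ∎
    where
    open ≤-Reasoning
    c = col j₀ y₀
    same-colour : ∀ y → ¬ Apart (j₀ , y₀) (j , y) → col j y ≡ c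
    same-colour y ¬apart = decidable-stable (col j y ≟ c) λ c≢ → ¬apart (≢-sym j≢j₀ , ≢-sym c≢)

  -- Part j is charged T j non-neighbours: all n of its vertices for j = j₀,
  -- and the vertices of colour c otherwise.
  degree-from-class-bound : ∀ {n r} D (i₀ : Fin r) (x₀ : Fin n) → let j₀ = toℕ i₀ ; c = col j₀ (toℕ x₀) in
    ∑[ j < r ] count n c j ≤ D + count n c j₀ → (r ∸ 1) * n ≤ degree colourGraph (i₀ , x₀) + D
  degree-from-class-bound {n} {suc r} D i₀ x₀ class≤ = +-cancelʳ-≤ n _ _ (begin
    r * n + n                            ≡⟨ +-comm (r * n) n ⟩
    suc r * n                            ≤⟨ ∑-≥ (suc r) (λ j _ → part-covered j) ⟩
    ∑[ j < suc r ] (A j + T j)           ≡⟨ ∑-+ (suc r) A T ⟩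
    ∑ (suc r) A + ∑ (suc r) T            ≤⟨ +-monoʳ-≤ (∑ (suc r) A) others ⟩
    ∑ (suc r) A + (D + n)                ≡⟨ cong (_+ (D + n)) (degree-colourGraph i₀ x₀) ⟨
    degree colourGraph (i₀ , x₀) + (D + n) ≡⟨ +-assoc _ D n ⟨
    degree colourGraph (i₀ , x₀) + D + n ∎)
    where
    open ≤-Reasoning
    j₀ = toℕ i₀
    y₀ = toℕ x₀
    c = col j₀ y₀
    A : ℕ → ℕ
    A j = ∑[ y < n ] 𝟙 (apart? (j₀ , y₀) (j , y))
    T : ℕ → ℕ
    T = update j₀ n (count n c)
    part-covered : ∀ j → n ≤ A j + T j
    part-covered j with j ≟ j₀
    ... | yes refl = ≤-trans (m≤n+m n (A j)) (≤-reflexive (cong (_+_ (A j)) (sym (update-here j₀ n (count n c)))))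
    ... | no j≢j₀  = ≤-trans (other-part-covered n j₀ y₀ j j≢j₀)
                             (≤-reflexive (cong (_+_ (A j)) (sym (update-there n (count n c) j≢j₀))))
    others : ∑ (suc r) T ≤ D + n
    others = +-cancelʳ-≤ (count n c j₀) _ _ (begin
      ∑ (suc r) T + count n c j₀   ≡⟨ ∑-update (suc r) n (count n c) (toℕ<n i₀) ⟩
      ∑ (suc r) (count n c) + n    ≤⟨ +-monoˡ-≤ n class≤ ⟩
      D + count n c j₀ + n         ≡⟨ +-assoc D _ n ⟩
      D + (count n c j₀ + n)       ≡⟨ cong (_+_ D) (+-comm _ n) ⟩
      D + (n + count n c j₀)       ≡⟨ +-assoc D n _ ⟨
      D + n + count n c j₀         ∎)

module GroupedColouring (mm X b k : ℕ) where

  m m′ parts : ℕ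
  m = 2 + mm
  m′ = 1 + mm
  parts = m * X + m′ * b

  colour : ℕ → ℕ → ℕ
  colour j y with j <? m * X | y <? k
  ... | yes _ | yes _ = j / m
  ... | yes _ | no _  = X
  ... | no _  | _     = suc X + (j ∸ m * X) / m′

  data ColourView (j y : ℕ) : ℕ → Set where
    grouped : j < m * X → y < k → ColourView j y (j / m)
    spare   : j < m * X → k ≤ y → ColourView j y X
    block   : m * X ≤ j → ColourView j y (suc X + (j ∸ m * X) / m′)

  colour-view : ∀ j y → ColourView j y (colour j y)
  colour-view j y with j <? m * X | y <? k
  ... | yes j< | yes y< = grouped j< y<
  ... | yes j< | no y≮  = spare j< (≮⇒≥ y≮)
  ... | no j≮  | _      = block (≮⇒≥ j≮)

  group<X : ∀ {j} → j < m * X → j / m < X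
  group<X {j} j< = m<n*o⇒m/o<n (<-≤-trans j< (≤-reflexive (*-comm m X)))

  colour-grouped : ∀ {j y} → j < m * X → y < k → colour j y ≡ j / m
  colour-grouped {j} {y} j< y< with colour j y | colour-view j y
  ... | _ | grouped _ _  = refl
  ... | _ | spare _ k≤y  = contradiction y< (≤⇒≯ k≤y)
  ... | _ | block mX≤j   = contradiction j< (≤⇒≯ mX≤j)

  colour-spare : ∀ {j y} → j < m * X → k ≤ y → colour j y ≡ X
  colour-spare {j} {y} j< k≤y with colour j y | colour-view j y
  ... | _ | grouped _ y< = contradiction y< (≤⇒≯ k≤y)
  ... | _ | spare _ _    = refl
  ... | _ | block mX≤j   = contradiction j< (≤⇒≯ mX≤j)

  colour-block : ∀ {j y} → m * X ≤ j → colour j y ≡ suc X + (j ∸ m * X) / m′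
  colour-block {j} {y} mX≤j with colour j y | colour-view j y
  ... | _ | grouped j< _ = contradiction j< (≤⇒≯ mX≤j)
  ... | _ | spare j< _   = contradiction j< (≤⇒≯ mX≤j)
  ... | _ | block _      = refl

  grouped-class : ∀ {j y g} → colour j y ≡ g → g < X → j / m ≡ g × y < k
  grouped-class {j} {y} eq g<X with colour j y | colour-view j y
  ... | _ | grouped _ y< = eq , y<
  ... | _ | spare _ _    = contradiction g<X (≤⇒≯ (≤-reflexive eq))
  ... | _ | block _      = contradiction g<X (≤⇒≯ (≤-trans (n≤1+n X) (≤-trans (m≤m+n (suc X) _) (≤-reflexive eq))))

  spare-class : ∀ {j y} → colour j y ≡ X → j < m * X × k ≤ y
  spare-class {j} {y} eq with colour j y | colour-view j y
  ... | _ | grouped j< _ = contradiction (group<X j<) (≤⇒≯ (≤-reflexive (sym eq)))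
  ... | _ | spare j< k≤y = j< , k≤y
  ... | _ | block _      = contradiction (≤-reflexive eq) (<⇒≱ (s≤s (m≤m+n X _)))

  block-class : ∀ {j y h} → colour j y ≡ suc X + h → m * X ≤ j × (j ∸ m * X) / m′ ≡ h
  block-class {j} {y} eq with colour j y | colour-view j y
  ... | _ | grouped j< _ = contradiction (≤-trans (m≤m+n (suc X) _) (≤-reflexive (sym eq))) (<⇒≱ (<-trans (group<X j<) (n<1+n X)))
  ... | _ | spare _ _    = contradiction (≤-trans (m≤m+n (suc X) _) (≤-reflexive (sym eq))) (<⇒≱ (n<1+n X))
  ... | _ | block mX≤j   = mX≤j , +-cancelˡ-≡ (suc X) _ _ eq

  colour-< : ∀ j y → j < parts → colour j y < suc X + b
  colour-< j y j<parts with colour j y | colour-view j y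
  ... | _ | grouped j< _ = <-≤-trans (group<X j<) (≤-trans (n≤1+n X) (m≤m+n (suc X) b))
  ... | _ | spare _ _    = s≤s (m≤m+n X b)
  ... | _ | block mX≤j   = +-monoʳ-< (suc X) (m<n*o⇒m/o<n (begin-strict
    j ∸ m * X           <⟨ ∸-monoˡ-< j<parts mX≤j ⟩
    parts ∸ m * X       ≡⟨ m+n∸m≡n (m * X) (m′ * b) ⟩
    m′ * b              ≡⟨ *-comm m′ b ⟩
    b * m′              ∎))
    where open ≤-Reasoning

  open ColourGraph colour

  module _ {n} (spare-bound : (m * X ∸ 1) * (n ∸ k) ≤ m′ * k) (block-bound : mm * n ≤ m′ * k) where

    class-bound : ∀ j₀ y₀ → ∑[ j < parts ] count n (colour j₀ y₀) j ≤ m′ * k + count n (colour j₀ y₀) j₀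
    class-bound j₀ y₀ with colour j₀ y₀ | colour-view j₀ y₀
    ... | _ | grouped j₀< y₀< = class-window n parts (j₀ / m) j₀ (j₀ / m * m) m
      (λ j y _ eq → subst (λ g → g * m ≤ j × j < g * m + m) (proj₁ (grouped-class eq (group<X j₀<))) (/-window j m))
      (λ j y eq → colour-grouped j₀< (proj₂ (grouped-class eq (group<X j₀<))))
      (count-window n (j₀ / m) j₀ 0 k λ y _ eq → z≤n , proj₂ (grouped-class eq (group<X j₀<)))
      ≤-refl
    ... | _ | spare j₀< k≤y₀ = class-window n parts X j₀ 0 (m * X)
      (λ j y _ eq → z≤n , proj₁ (spare-class eq))
      (λ j y eq → colour-spare j₀< (proj₂ (spare-class eq)))
      (count-window n X j₀ k (n ∸ k) λ y y<n eq → proj₂ (spare-class eq) , <-≤-trans y<n (m≤n+m∸n n k))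
      spare-bound
    ... | _ | block mX≤j₀ = class-window n parts (suc X + h) j₀ (m * X + h * m′) m′
      (λ j y _ eq → let mX≤j , j∸mX/m′≡h = block-class eq in
        window-shift mX≤j (subst (λ q → q * m′ ≤ j ∸ m * X × j ∸ m * X < q * m′ + m′) j∸mX/m′≡h
                                 (/-window (j ∸ m * X) m′)))
      (λ j y eq → colour-block mX≤j₀)
      (count-≤ n (suc X + h) j₀)
      block-bound
      where h = (j₀ ∸ m * X) / m′

    degree-bound : ∀ (v : Vertex n parts) → (parts ∸ 1) * n ≤ degree colourGraph v + m′ * k
    degree-bound (i₀ , x₀) = degree-from-class-bound {n} {parts} (m′ * k) i₀ x₀ (class-bound (toℕ i₀) (toℕ x₀))

square-split : ∀ mm → (2 + mm) * (2 + mm) ≡ suc (mm * suc mm) + 3 * suc mm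
square-split = solve-∀

*-distribˡ-suc-+ : ∀ mm P → mm * suc (P + mm) ≡ mm * suc mm + mm * P
*-distribˡ-suc-+ = solve-∀

*-comm-middle : ∀ a b c → a * (b * c) ≡ b * a * c
*-comm-middle = solve-∀

-- k ≥ P n / (P + m - 1) is exactly what the spare class needs; the block
-- classes then fit as well because m ≤ X.
balanced-bounds : ∀ mm X n k → let m = 2 + mm ; P = m * X ∸ 1 in
  m ≤ X → P * n ≤ suc (P + mm) * k → P * (n ∸ k) ≤ suc mm * k × mm * n ≤ suc mm * k
balanced-bounds mm X n k m≤X key = spare-bound , block-bound
  where
  open ≤-Reasoning
  m = 2 + mm
  P = m * X ∸ 1
  spare-bound : P * (n ∸ k) ≤ suc mm * k
  spare-bound = begin
    P * (n ∸ k)              ≡⟨ *-distribˡ-∸ P n k ⟩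
    P * n ∸ P * k            ≤⟨ ∸-monoˡ-≤ (P * k) key ⟩
    suc (P + mm) * k ∸ P * k ≡⟨ *-distribʳ-∸ k (suc (P + mm)) P ⟨
    (suc (P + mm) ∸ P) * k   ≡⟨ cong (λ d → (d ∸ P) * k) (+-suc P mm) ⟨
    (P + suc mm ∸ P) * k     ≡⟨ cong (_* k) (m+n∸m≡n P (suc mm)) ⟩
    suc mm * k               ∎
  mm*m′≤P : mm * suc mm ≤ P
  mm*m′≤P = ∸-monoˡ-≤ 1 (begin
    suc (mm * suc mm)                ≤⟨ m≤m+n _ (3 * suc mm) ⟩
    suc (mm * suc mm) + 3 * suc mm   ≡⟨ square-split mm ⟨
    m * m                            ≤⟨ *-monoʳ-≤ m m≤X ⟩
    m * X                            ∎)
  block-bound : mm * n ≤ suc mm * k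
  block-bound = *-cancelˡ-≤ (suc (P + mm)) (begin
    suc (P + mm) * (mm * n)          ≡⟨ *-comm-middle (suc (P + mm)) mm n ⟩
    mm * suc (P + mm) * n            ≡⟨ cong (_* n) (*-distribˡ-suc-+ mm P) ⟩
    (mm * suc mm + mm * P) * n       ≤⟨ *-monoˡ-≤ n (+-monoˡ-≤ (mm * P) mm*m′≤P) ⟩
    suc mm * P * n                   ≡⟨ *-assoc (suc mm) P n ⟩
    suc mm * (P * n)                 ≤⟨ *-monoʳ-≤ (suc mm) key ⟩
    suc mm * (suc (P + mm) * k)      ≡⟨ *-comm-middle (suc mm) (suc (P + mm)) k ⟩
    suc (P + mm) * suc mm * k        ≡⟨ *-assoc (suc (P + mm)) (suc mm) k ⟩
    suc (P + mm) * (suc mm * k)      ∎)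

ceilDiv-spec-at-t-a : ∀ mm a z n → let m = 2 + mm ; P = m * (z + m) ∸ 1 in
  P * n ≤ suc (P + mm) * ceilDiv ((m * ((suc a + z ∸ 1 ∸ a) + m) ∸ 1) * n) (m * ((suc a + z ∸ a) + m) ∸ 2)
ceilDiv-spec-at-t-a mm a z n =
  subst₂ (λ u v → P * n ≤ suc (P + mm) * ceilDiv ((m * (u + m) ∸ 1) * n) (m * (v + m) ∸ 2))
    (sym (m+n∸m≡n a z)) (sym gap≡)
    (subst (λ d → P * n ≤ suc (P + mm) * ceilDiv (P * n) d) (sym divisor≡) (ceilDiv-spec (P * n) (P + mm)))
  where
  open ≡-Reasoning
  m = 2 + mm
  P = m * (z + m) ∸ 1
  gap≡ : suc a + z ∸ a ≡ suc z
  gap≡ = trans (cong (_∸ a) (sym (+-suc a z))) (m+n∸m≡n a (suc z))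
  1≤mX : 1 ≤ m * (z + m)
  1≤mX = ≤-trans (s≤s z≤n) (≤-trans (m≤n+m m z) (m≤m+n (z + m) _))
  divisor≡ : m * (suc z + m) ∸ 2 ≡ suc (P + mm)
  divisor≡ = begin
    m * (suc z + m) ∸ 2  ≡⟨ cong (_∸ 2) (*-suc m (z + m)) ⟩
    mm + m * (z + m)     ≡⟨ +-comm mm _ ⟩
    m * (z + m) + mm     ≡⟨ cong (_+ mm) (m∸n+n≡m 1≤mX) ⟨
    P + 1 + mm           ≡⟨ cong (_+ mm) (+-comm P 1) ⟩
    suc P + mm           ∎

parts-identity : ∀ mm w z → (2 + mm) * (z + (2 + mm)) + (1 + mm) * suc w + (3 + mm + w) ≡ (2 + mm) * (4 + mm + w + z)
parts-identity = solve-∀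

colours-identity : ∀ mm w z → suc (z + (2 + mm)) + suc w ≡ 4 + mm + w + z
colours-identity = solve-∀

proposition4p2 : ∀ (r t m a : ℕ) → t < r → 3 ≤ t → r + a ≡ m * t
    → 2 ≤ m → m < a → a < t → ∀ (n : ℕ) → 1 ≤ n
    → Σ ℕ λ f → Σ ℕ λ δ → IsF n r (t + 1) f × IsDelta n r t δ × δ ≤ f
    × (+ ((r ∸ 1) * n)
    - + ((m ∸ 1) * ceilDiv ((m * ((t ∸ 1 ∸ a) + m) ∸ 1) * n) (m * ((t ∸ a) + m) ∸ 2))
    ≤ℤ + δ)
-- The hypothesis 3 ≤ t is implied by 2 ≤ m < a < t.
proposition4p2 r t _ a t<r _ r+a≡mt (s≤s (s≤s (z≤n {mm}))) m<a a<t (suc n′) _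
  with w , refl ← m≤n⇒∃[o]m+o≡n m<a
  with z , refl ← m≤n⇒∃[o]m+o≡n a<t
  with refl ← +-cancelʳ-≡ _ r _ (trans r+a≡mt (sym (parts-identity mm w z)))
  = bounds-from-colourable colourGraph
      (colourGraph-chromatic λ j y j<r _ → <-≤-trans (colour-< j y j<r) (≤-reflexive (colours-identity mm w z)))
      (fromℕ< (<-≤-trans z<s t<r) , zero)
      (uncurry degree-bound (balanced-bounds mm (z + m) n K (m≤n+m m z) (ceilDiv-spec-at-t-a mm a′ z n)))
  where
  n = suc n′
  a′ = 3 + mm + w
  K = ceilDiv (((2 + mm) * ((suc a′ + z ∸ 1 ∸ a′) + (2 + mm)) ∸ 1) * n) ((2 + mm) * ((suc a′ + z ∸ a′) + (2 + mm)) ∸ 2)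
  open GroupedColouring mm (z + (2 + mm)) (suc w) K
  open ColourGraph colour
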